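{- Let $G$ be a graph with vertex integrity $p$, let $S$ witness this, and let $\mathcal{C}$ be the set of connected components of $G-S$. If $G'$ is the reduced graph of $G$, then $|V(G')| \le p+p^2\cdot f(p)\cdot 2^{2p^2}$, where $f(p)=2^{7p^3}$; in particular $|V(G')|\in 2^{\mathcal{O}(p^3)}$.
   Context: The vertex integrity of a graph $G$ is the smallest integer $p$ such that there is a set $S\subseteq V(G)$ with $|V(K)\cup S|\le p$ for every connected component $K$ of $G-S$; such an $S$ witnesses it. Two components $H_0,H_1\in\mathcal{C}$ are twin-blocks, written $H_0\sim H_1$, if there is an isomorphism $\alpha$ from $H_0$ to $H_1$ such that for all $u\in V(H_0)$ and $v\in S$, $uv\in E(G)$ iff $\alpha(u)v\in E(G)$; $\sim$ is an equivalence relation. An equivalence class $[H_0]_\sim$ is large in an induced subgraph $G''$ of $G$ if at least $f(p)=2^{7p^3}$ members $H$ of the class satisfy $H\subseteq G''$. The reduced graph of $G$ is obtained from $G$ by removing all but $f(p)$ twin-blocks from each class of $\sim$ that is large (in $G$). -}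

module Defs where

open import Data.Nat using (ℕ; _+_; _*_; _^_; _≤_; _<_)
open import Data.Bool using (Bool; true; false)
open import Data.Fin using (Fin)
open import Data.Fin.Subset using (Subset; _∈_; _∉_; _⊆_; _∪_; ∣_∣; Nonempty)
open import Data.List using (List; length)
import Data.List.Membership.Propositional as LM
open import Data.List.Relation.Unary.Unique.Propositional using (Unique)
open import Data.Product using (Σ; ∃; _×_; _,_)
open import Data.Sum using (_⊎_)
open import Relation.Binary.PropositionalEquality using (_≡_)
open import Relation.Nullary using (¬_)

record Graph (n : ℕ) : Set where
  field
    adj    : Fin n → Fin n → Bool
    sym    : ∀ u v → adj u v ≡ adj v u
    irrefl : ∀ v → adj v v ≡ false
open Graph public

module _ {n : ℕ} (G : Graph n) (S : Subset n) where

  data PathAvoid : Fin n → Fin n → Set where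
    here : ∀ {v} → v ∉ S → PathAvoid v v
    step : ∀ {u w v} → u ∉ S → adj G u w ≡ true → PathAvoid w v → PathAvoid u v

  IsComponent : Subset n → Set
  IsComponent K =
    Nonempty K
    × (∀ v → v ∈ K → v ∉ S)
    × (∀ u v → u ∈ K → v ∈ K → PathAvoid u v)
    × (∀ u v → u ∈ K → v ∉ S → adj G u v ≡ true → v ∈ K)

  TwinBlocks : Subset n → Subset n → Set
  TwinBlocks H0 H1 =
    IsComponent H0 × IsComponent H1 ×
    Σ (Fin n → Fin n) λ α →
      (∀ u → u ∈ H0 → α u ∈ H1)
      × (∀ u w → u ∈ H0 → w ∈ H0 → α u ≡ α w → u ≡ w)
      × (∀ v → v ∈ H1 → ∃ λ u → u ∈ H0 × α u ≡ v)
      × (∀ u w → u ∈ H0 → w ∈ H0 → adj G (α u) (α w) ≡ adj G u w)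
      × (∀ u v → u ∈ H0 → v ∈ S → adj G (α u) v ≡ adj G u v)

Witnesses≤ : ∀ {n} → Graph n → Subset n → ℕ → Set
Witnesses≤ G S p = ∣ S ∣ ≤ p × (∀ K → IsComponent G S K → ∣ K ∪ S ∣ ≤ p)

VertexIntegrity : ∀ {n} → Graph n → ℕ → Set
VertexIntegrity {n} G p =
  (∃ λ (S : Subset n) → Witnesses≤ G S p) × (∀ q (S : Subset n) → Witnesses≤ G S q → p ≤ q)

WitnessesVI : ∀ {n} → Graph n → Subset n → ℕ → Set
WitnessesVI G S p = VertexIntegrity G p × Witnesses≤ G S p

CountIs : ∀ {n} → (Subset n → Set) → ℕ → Set
CountIs {n} P k =
  Σ (List (Subset n)) λ xs → Unique xs × (∀ x → (x LM.∈ xs → P x) × (P x → x LM.∈ xs)) × length xs ≡ k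

f : ℕ → ℕ
f p = 2 ^ (7 * p ^ 3)

-- R is the vertex set of a reduced graph of G (w.r.t. S and p): obtained from G by removing,
-- from each class of ~ that is large (≥ f p members), all but f p of its twin-blocks;
-- nothing else is removed.
IsReduced : ∀ {n} → Graph n → Subset n → ℕ → Subset n → Set
IsReduced {n} G S p R =
  (∀ v → v ∈ S → v ∈ R)
  × (∀ K → IsComponent G S K → K ⊆ R ⊎ (∀ v → v ∈ K → v ∉ R))
  × (∀ H N M → IsComponent G S H
       → CountIs (λ K → TwinBlocks G S H K) N
       → CountIs (λ K → TwinBlocks G S H K × K ⊆ R) M
       → (f p ≤ N → M ≡ f p) × (N < f p → M ≡ N))

{-# OPTIONS --safe #-}
-- Every component of G − S has at most p vertices. Listing its vertices in increasing order,
-- record its size, its adjacency matrix and its adjacency to S, padded to p × p: two components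
-- with the same such signature are twin blocks, the isomorphism matching vertices at equal
-- positions. There are p · 2^(2p²) signatures and the reduced graph keeps at most f(p) blocks
-- of each twin class, so besides S it retains at most p · 2^(2p²) · f(p) components, each of
-- at most p vertices.
--
-- The counting needs connectivity in G − S and twin-hood to be decidable. As the conclusion is
-- a decidable inequality, it is proved inside the double-negation monad, where excluded middle
-- for these finitely many propositions holds.

module Submission where

open import Defs
open import Data.Nat using (ℕ; _+_; _*_; _^_; _≤_)
open import Data.Fin.Subset using (Subset; ∣_∣)

open import Data.Bool using (Bool; true; false) renaming (_≟_ to _≟ᵇ_)
open import Data.Fin using (Fin; zero; suc; toℕ; fromℕ<)
open import Data.Fin.Properties using (toℕ-fromℕ<; suc-injective) renaming (_≟_ to _≟ᶠ_)
open import Data.Fin.Subset using (inside; outside; _∈_; _∉_; _⊆_; Nonempty)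
open import Data.Fin.Subset.Properties using (_∈?_; _⊆?_; ∣p∣≤∣p∪q∣)
open import Data.List using (List; []; _∷_; [_]; length; map; filter; _++_; concatMap; applyUpTo; allFin; cartesianProduct; cartesianProductWith)
open import Data.List.Properties using (length-map; length-++; length-removeAt′; length-applyUpTo)
open import Data.List.Membership.Propositional using (_─_) renaming (_∈_ to _∈ᴸ_)
open import Data.List.Membership.Propositional.Properties
  using (∈-map⁺; ∈-map⁻; ∈-++⁺ˡ; ∈-++⁺ʳ; ∈-filter⁺; ∈-filter⁻; ∈-allFin; ∈-applyUpTo⁺; ∈-length; ∈-concat⁺′; ∈-cartesianProductWith⁺; ∈-cartesianProduct⁺)
open import Data.List.Relation.Binary.Subset.Propositional using () renaming (_⊆_ to _⊆ᴸ_)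
open import Data.List.Relation.Unary.All as All using (All; []; _∷_)
import Data.List.Relation.Unary.All.Properties as All
open import Data.List.Relation.Unary.AllPairs using ([]; _∷_)
open import Data.List.Relation.Unary.Any using (here; there; index)
open import Data.List.Relation.Unary.Unique.Propositional using (Unique)
open import Data.List.Relation.Unary.Unique.Propositional.Properties using (map⁺; filter⁺; cartesianProductWith⁺)
open import Data.Maybe using (Maybe; just; nothing; fromMaybe)
open import Data.Maybe.Properties using (just-injective)
open import Data.Nat using (zero; suc; _<_; z≤n; s≤s; _≤?_)
open import Data.Nat.Properties
  using (≤-trans; ≤-reflexive; <⇒≤; ≰⇒>; +-suc; +-mono-≤; +-monoʳ-≤; *-monoˡ-≤; ^-*-assoc; ^-distribˡ-+-*; +-identityʳ; *-identityʳ; module ≤-Reasoning)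
  renaming (_≟_ to _≟ⁿ_)
open import Data.Nat.Solver using (module +-*-Solver)
open import Data.Product using (∃; _×_; _,_; proj₁; proj₂; map₁)
open import Data.Product.Properties using () renaming (≡-dec to ×-≡-dec)
open import Data.Sum using (inj₁; inj₂)
open import Data.Vec using (Vec; []; _∷_; here; there; tabulate; lookup)
open import Data.Vec.Properties using (lookup∘tabulate; lookup⇒[]=; []=⇒lookup; ∷-injective) renaming (≡-dec to Vec-≡-dec)
open import Effect.Monad using (RawMonad)
open import Function using (_∘_)
open import Level using (0ℓ)
open import Relation.Binary.Definitions using (DecidableEquality)
open import Relation.Binary.PropositionalEquality as ≡ using (_≡_; _≢_; refl; cong; cong₂; subst; module ≡-Reasoning)
open import Relation.Nullary using (¬_; Dec; yes; no; does; contradiction)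
open import Relation.Nullary.Decidable using (_×-dec_; decidable-stable; ¬¬-excluded-middle; dec-true)
open import Relation.Nullary.Negation using (¬¬-Monad; ¬¬-map)
open import Relation.Unary using (Pred; Decidable)
open import Relation.Unary.Properties using (∁?)

module _ {A : Set} where

  ¬¬-∀-enumerated : {P : A → Set} (xs : List A) → (∀ x → x ∈ᴸ xs) → (∀ x → ¬ ¬ P x) → ¬ ¬ (∀ x → P x)
  ¬¬-∀-enumerated xs xs-complete ¬¬P =
    ¬¬-map (λ all x → All.lookup all (xs-complete x))
           (All.sequenceA _ (RawMonad.rawApplicative ¬¬-Monad) (All.tabulate λ {x} _ → ¬¬P x))

  ∈-─⁺ : ∀ {x z} {ys : List A} (x∈ys : x ∈ᴸ ys) → z ∈ᴸ ys → x ≢ z → z ∈ᴸ ys ─ x∈ys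
  ∈-─⁺ (here refl)  (here refl)  x≢z = contradiction refl x≢z
  ∈-─⁺ (here refl)  (there z∈ys) _   = z∈ys
  ∈-─⁺ (there _)    (here refl)  _   = here refl
  ∈-─⁺ (there x∈ys) (there z∈ys) x≢z = there (∈-─⁺ x∈ys z∈ys x≢z)

  Unique⇒length≤ : ∀ {xs ys : List A} → Unique xs → xs ⊆ᴸ ys → length xs ≤ length ys
  Unique⇒length≤ {[]}     _               _     = z≤n
  Unique⇒length≤ {x ∷ xs} {ys} (x∉xs ∷ xs!) xs⊆ys = begin
    suc (length xs)          ≤⟨ s≤s (Unique⇒length≤ xs! xs⊆ys─x) ⟩
    suc (length (ys ─ x∈ys)) ≡⟨ length-removeAt′ ys (index x∈ys) ⟨
    length ys                ∎
    where
    open ≤-Reasoning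
    x∈ys = xs⊆ys (here refl)
    xs⊆ys─x : xs ⊆ᴸ ys ─ x∈ys
    xs⊆ys─x z∈xs = ∈-─⁺ x∈ys (xs⊆ys (there z∈xs)) (All.lookup x∉xs z∈xs)

  length-filter+length-filter-∁ : {P : Pred A 0ℓ} (P? : Decidable P) (xs : List A) →
    length (filter P? xs) + length (filter (∁? P?) xs) ≡ length xs
  length-filter+length-filter-∁ P? [] = refl
  length-filter+length-filter-∁ P? (x ∷ xs) with P? x
  ... | yes _ = cong suc (length-filter+length-filter-∁ P? xs)
  ... | no  _ = ≡.trans (+-suc _ _) (cong suc (length-filter+length-filter-∁ P? xs))

  length-concatMap≤ : ∀ {B : Set} (g : A → List B) {k} (xs : List A) →
    (∀ {x} → x ∈ᴸ xs → length (g x) ≤ k) → length (concatMap g xs) ≤ length xs * k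
  length-concatMap≤ g [] _ = z≤n
  length-concatMap≤ g (x ∷ xs) g≤k = begin
    length (g x ++ concatMap g xs)         ≡⟨ length-++ (g x) ⟩
    length (g x) + length (concatMap g xs) ≤⟨ +-mono-≤ (g≤k (here refl)) (length-concatMap≤ g xs (g≤k ∘ there)) ⟩
    _ + length xs * _                      ∎
    where open ≤-Reasoning

  module _ {C : Set} (_≟_ : DecidableEquality C) (c : A → C) (F : ℕ) where

    length≤-fibres : (cs : List C) {xs : List A} → Unique xs → (∀ {x} → x ∈ᴸ xs → c x ∈ᴸ cs) →
      (∀ y {ys} → Unique ys → (∀ {x} → x ∈ᴸ ys → x ∈ᴸ xs × c x ≡ y) → length ys ≤ F) →
      length xs ≤ length cs * F
    length≤-fibres [] {[]}    _ _  _ = z≤n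
    length≤-fibres [] {x ∷ _} _ c∈ _ with () ← c∈ (here refl)
    length≤-fibres (y ∷ cs) {xs} xs! c∈ fibre≤ = begin
      length xs                                     ≡⟨ length-filter+length-filter-∁ (c-is? y) xs ⟨
      length (filter (c-is? y) xs) + length others ≤⟨ +-mono-≤ fibre-y≤ others≤ ⟩
      F + length cs * F                             ∎
      where
      open ≤-Reasoning
      c-is? : (z : C) → Decidable (λ x → c x ≡ z)
      c-is? z x = c x ≟ z
      others = filter (∁? (c-is? y)) xs
      fibre-y≤ = fibre≤ y (filter⁺ (c-is? y) xs!) (∈-filter⁻ (c-is? y))
      others-c∈ : ∀ {x} → x ∈ᴸ others → c x ∈ᴸ cs
      others-c∈ x∈ with (x∈xs , cx≢y) ← ∈-filter⁻ (∁? (c-is? y)) x∈ | c∈ x∈xs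
      ... | here cx≡y = contradiction cx≡y cx≢y
      ... | there cx∈cs = cx∈cs
      others⊆xs : ∀ {x} → x ∈ᴸ others → x ∈ᴸ xs
      others⊆xs = proj₁ ∘ ∈-filter⁻ (∁? (c-is? y))
      others≤ = length≤-fibres cs (filter⁺ (∁? (c-is? y)) xs!) others-c∈
        λ y′ ys! ys⊆ → fibre≤ y′ ys! λ x∈ys → map₁ others⊆xs (ys⊆ x∈ys)

length-cartesianProductWith : ∀ {A B C : Set} (g : A → B → C) (xs : List A) (ys : List B) →
  length (cartesianProductWith g xs ys) ≡ length xs * length ys
length-cartesianProductWith g []       ys = refl
length-cartesianProductWith g (x ∷ xs) ys = begin
  length (map (g x) ys ++ cartesianProductWith g xs ys)
    ≡⟨ length-++ (map (g x) ys) ⟩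
  length (map (g x) ys) + length (cartesianProductWith g xs ys)
    ≡⟨ cong₂ _+_ (length-map (g x) ys) (length-cartesianProductWith g xs ys) ⟩
  length ys + length xs * length ys ∎
  where open ≡-Reasoning

module _ {A : Set} where

  vectorsOver : List A → (m : ℕ) → List (Vec A m)
  vectorsOver xs zero    = [ [] ]
  vectorsOver xs (suc m) = cartesianProductWith _∷_ xs (vectorsOver xs m)

  length-vectorsOver : (xs : List A) (m : ℕ) → length (vectorsOver xs m) ≡ length xs ^ m
  length-vectorsOver xs zero    = refl
  length-vectorsOver xs (suc m) =
    ≡.trans (length-cartesianProductWith _∷_ xs (vectorsOver xs m)) (cong (length xs *_) (length-vectorsOver xs m))

  ∈-vectorsOver : {xs : List A} → (∀ x → x ∈ᴸ xs) → ∀ {m} (v : Vec A m) → v ∈ᴸ vectorsOver xs m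
  ∈-vectorsOver xs-complete []       = here refl
  ∈-vectorsOver xs-complete (x ∷ v) =
    ∈-cartesianProductWith⁺ _∷_ (xs-complete x) (∈-vectorsOver xs-complete v)

  vectorsOver-unique : {xs : List A} → Unique xs → ∀ m → Unique (vectorsOver xs m)
  vectorsOver-unique xs! zero    = [] ∷ []
  vectorsOver-unique xs! (suc m) = cartesianProductWith⁺ _∷_ ∷-injective xs! (vectorsOver-unique xs! m)

booleans : List Bool
booleans = true ∷ false ∷ []

∈-booleans : ∀ b → b ∈ᴸ booleans
∈-booleans true  = here refl
∈-booleans false = there (here refl)

subsets : (n : ℕ) → List (Subset n)
subsets = vectorsOver booleans

∈-subsets : ∀ {n} (K : Subset n) → K ∈ᴸ subsets n
∈-subsets = ∈-vectorsOver ∈-booleans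

subsets-unique : ∀ n → Unique (subsets n)
subsets-unique = vectorsOver-unique (((λ ()) ∷ []) ∷ [] ∷ [])

countIs-filter : ∀ {n} {P : Subset n → Set} (P? : Decidable P) → CountIs P (length (filter P? (subsets n)))
countIs-filter {n} P? =
  filter P? (subsets n) , filter⁺ P? (subsets-unique n) ,
  (λ K → proj₂ ∘ ∈-filter⁻ P? {xs = subsets n} , ∈-filter⁺ P? (∈-subsets K)) , refl

elements : ∀ {n} → Subset n → List (Fin n)
elements []            = []
elements (inside ∷ K)  = zero ∷ map suc (elements K)
elements (outside ∷ K) = map suc (elements K)

length-elements : ∀ {n} (K : Subset n) → length (elements K) ≡ ∣ K ∣
length-elements []            = refl
length-elements (inside ∷ K)  = cong suc (≡.trans (length-map suc (elements K)) (length-elements K))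
length-elements (outside ∷ K) = ≡.trans (length-map suc (elements K)) (length-elements K)

length-elements≤ : ∀ {n k} (K : Subset n) → ∣ K ∣ ≤ k → length (elements K) ≤ k
length-elements≤ K = ≤-trans (≤-reflexive (length-elements K))

∈-elements⁺ : ∀ {n} {x : Fin n} {K : Subset n} → x ∈ K → x ∈ᴸ elements K
∈-elements⁺ {K = inside ∷ K}  here       = here refl
∈-elements⁺ {K = inside ∷ K}  (there x∈K) = there (∈-map⁺ suc (∈-elements⁺ x∈K))
∈-elements⁺ {K = outside ∷ K} (there x∈K) = ∈-map⁺ suc (∈-elements⁺ x∈K)

∈-elements⁻ : ∀ {n} {x : Fin n} (K : Subset n) → x ∈ᴸ elements K → x ∈ K
∈-elements⁻ (inside ∷ K) (here refl) = here
∈-elements⁻ (inside ∷ K) (there x∈) with (y , y∈ , refl) ← ∈-map⁻ suc x∈ = there (∈-elements⁻ K y∈)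
∈-elements⁻ (outside ∷ K) x∈ with (y , y∈ , refl) ← ∈-map⁻ suc x∈ = there (∈-elements⁻ K y∈)

elements-unique : ∀ {n} (K : Subset n) → Unique (elements K)
elements-unique []            = []
elements-unique (inside ∷ K)  = zero∉ ∷ map⁺ suc-injective (elements-unique K)
  where
  zero∉ : All (zero ≢_) (map suc (elements K))
  zero∉ = All.map⁺ (All.universal (λ _ ()) (elements K))
elements-unique (outside ∷ K) = map⁺ suc-injective (elements-unique K)

module _ {A : Set} where

  nth : List A → ℕ → Maybe A
  nth []       _       = nothing
  nth (x ∷ xs) zero    = just x
  nth (x ∷ xs) (suc i) = nth xs i

  nth⇒∈ : ∀ (xs : List A) {i x} → nth xs i ≡ just x → x ∈ᴸ xs
  nth⇒∈ (y ∷ xs) {zero}  refl = here refl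
  nth⇒∈ (y ∷ xs) {suc i} eq   = there (nth⇒∈ xs eq)

  nth-fromMaybe : ∀ (xs : List A) {i} d → i < length xs → nth xs i ≡ just (fromMaybe d (nth xs i))
  nth-fromMaybe (x ∷ xs) {zero}  d _         = refl
  nth-fromMaybe (x ∷ xs) {suc i} d (s≤s i<) = nth-fromMaybe xs d i<

  module _ (_≟_ : DecidableEquality A) where

    indexOf : A → List A → ℕ
    indexOf x []       = 0
    indexOf x (y ∷ ys) with x ≟ y
    ... | yes _ = 0
    ... | no  _ = suc (indexOf x ys)

    indexOf<length : ∀ {x} xs → x ∈ᴸ xs → indexOf x xs < length xs
    indexOf<length {x} (y ∷ ys) x∈ with x ≟ y | x∈
    ... | yes _   | _          = s≤s z≤n
    ... | no  x≢y | here x≡y   = contradiction x≡y x≢y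
    ... | no  _   | there x∈ys = s≤s (indexOf<length ys x∈ys)

    nth-indexOf : ∀ {x} xs → x ∈ᴸ xs → nth xs (indexOf x xs) ≡ just x
    nth-indexOf {x} (y ∷ ys) x∈ with x ≟ y | x∈
    ... | yes x≡y | _          = cong just (≡.sym x≡y)
    ... | no  x≢y | here x≡y   = contradiction x≡y x≢y
    ... | no  _   | there x∈ys = nth-indexOf ys x∈ys

    indexOf-nth : ∀ {xs i x} → Unique xs → nth xs i ≡ just x → indexOf x xs ≡ i
    indexOf-nth {y ∷ ys} {zero} {x} _ refl with x ≟ x
    ... | yes _   = refl
    ... | no  x≢x = contradiction refl x≢x
    indexOf-nth {y ∷ ys} {suc i} {x} (y∉ys ∷ ys!) eq with x ≟ y
    ... | yes refl = contradiction refl (All.lookup y∉ys (nth⇒∈ ys eq))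
    ... | no  _    = cong suc (indexOf-nth ys! eq)

module _ {n : ℕ} (G : Graph n) (S : Subset n) where

  path-source∉ : ∀ {u v} → PathAvoid G S u v → u ∉ S
  path-source∉ (here u∉S)     = u∉S
  path-source∉ (step u∉S _ _) = u∉S

  path-target∉ : ∀ {u v} → PathAvoid G S u v → v ∉ S
  path-target∉ (here v∉S)      = v∉S
  path-target∉ (step _ _ path) = path-target∉ path

  path-++ : ∀ {u v w} → PathAvoid G S u v → PathAvoid G S v w → PathAvoid G S u w
  path-++ (here _)           path′ = path′
  path-++ (step u∉S uw path) path′ = step u∉S uw (path-++ path path′)

  path-reverse : ∀ {u v} → PathAvoid G S u v → PathAvoid G S v u
  path-reverse (here v∉S) = here v∉S
  path-reverse (step {u} {w} u∉S uw path) =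
    path-++ (path-reverse path) (step (path-source∉ path) (≡.trans (sym G w u) uw) (here u∉S))

  module _ (path? : ∀ u v → Dec (PathAvoid G S u v)) where

    reachableFrom : Fin n → Subset n
    reachableFrom u = tabulate (does ∘ path? u)

    ∈-reachableFrom⁺ : ∀ {u v} → PathAvoid G S u v → v ∈ reachableFrom u
    ∈-reachableFrom⁺ {u} {v} path =
      lookup⇒[]= v _ (≡.trans (lookup∘tabulate (does ∘ path? u) v) (dec-true (path? u v) path))

    ∈-reachableFrom⁻ : ∀ {u v} → v ∈ reachableFrom u → PathAvoid G S u v
    ∈-reachableFrom⁻ {u} {v} v∈ with path? u v | ≡.trans (≡.sym (lookup∘tabulate (does ∘ path? u) v)) ([]=⇒lookup v∈)
    ... | yes path | _  = path
    ... | no  _    | ()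

    reachableFrom-component : ∀ {u} → u ∉ S → IsComponent G S (reachableFrom u)
    reachableFrom-component u∉S =
      (_ , ∈-reachableFrom⁺ (here u∉S)) ,
      (λ v v∈ → path-target∉ (∈-reachableFrom⁻ v∈)) ,
      (λ v w v∈ w∈ → path-++ (path-reverse (∈-reachableFrom⁻ v∈)) (∈-reachableFrom⁻ w∈)) ,
      (λ v w v∈ w∉S vw → let path = ∈-reachableFrom⁻ v∈ in
                          ∈-reachableFrom⁺ (path-++ path (step (path-target∉ path) vw (here w∉S))))

module _ {n : ℕ} (G : Graph n) where

  adjᴹ : Maybe (Fin n) → Maybe (Fin n) → Bool
  adjᴹ (just u) (just v) = adj G u v
  adjᴹ _        _        = false

  adjacencyMatrix : (p : ℕ) → List (Fin n) → List (Fin n) → Vec (Vec Bool p) p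
  adjacencyMatrix p us vs = tabulate λ i → tabulate λ j → adjᴹ (nth us (toℕ i)) (nth vs (toℕ j))

  lookup-adjacencyMatrix : ∀ {p} us vs (i j : Fin p) →
    lookup (lookup (adjacencyMatrix p us vs) i) j ≡ adjᴹ (nth us (toℕ i)) (nth vs (toℕ j))
  lookup-adjacencyMatrix us vs i j = begin
    lookup (lookup (tabulate row) i) j ≡⟨ cong (λ r → lookup r j) (lookup∘tabulate row i) ⟩
    lookup (row i) j                   ≡⟨ lookup∘tabulate _ j ⟩
    adjᴹ (nth us (toℕ i)) (nth vs (toℕ j)) ∎
    where
    open ≡-Reasoning
    row = λ i → tabulate λ j → adjᴹ (nth us (toℕ i)) (nth vs (toℕ j))

  adjacencyMatrix-≡⇒adjᴹ-≡ : ∀ {p us vs us′ vs′} →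
    adjacencyMatrix p us vs ≡ adjacencyMatrix p us′ vs′ →
    ∀ {i j} → i < p → j < p → adjᴹ (nth us i) (nth vs j) ≡ adjᴹ (nth us′ i) (nth vs′ j)
  adjacencyMatrix-≡⇒adjᴹ-≡ {p} {us} {vs} {us′} {vs′} M≡M′ {i} {j} i<p j<p = begin
    adjᴹ (nth us i) (nth vs j)                         ≡⟨ at us vs ⟨
    lookup (lookup (adjacencyMatrix p us vs) i′) j′    ≡⟨ cong (λ M → lookup (lookup M i′) j′) M≡M′ ⟩
    lookup (lookup (adjacencyMatrix p us′ vs′) i′) j′  ≡⟨ at us′ vs′ ⟩
    adjᴹ (nth us′ i) (nth vs′ j)                       ∎
    where
    open ≡-Reasoning
    i′ = fromℕ< i<p
    j′ = fromℕ< j<p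
    at : ∀ xs ys → lookup (lookup (adjacencyMatrix p xs ys) i′) j′ ≡ adjᴹ (nth xs i) (nth ys j)
    at xs ys = ≡.trans (lookup-adjacencyMatrix xs ys i′ j′)
                       (cong₂ (λ a b → adjᴹ (nth xs a) (nth ys b)) (toℕ-fromℕ< i<p) (toℕ-fromℕ< j<p))

-- Positions past the end of a vertex list read as non-adjacent, so the matrices alone do not
-- determine the size of a block; the signature records it separately.
Signature : ℕ → Set
Signature p = ℕ × Vec (Vec Bool p) p × Vec (Vec Bool p) p

_≟ˢ_ : ∀ {p} → DecidableEquality (Signature p)
_≟ˢ_ = ×-≡-dec _≟ⁿ_ (×-≡-dec matrix-≟ matrix-≟)
  where matrix-≟ = Vec-≡-dec (Vec-≡-dec _≟ᵇ_)

signature : ∀ {n} → Graph n → Subset n → (p : ℕ) → Subset n → Signature p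
signature G S p K =
  length (elements K) , adjacencyMatrix G p (elements K) (elements K) , adjacencyMatrix G p (elements K) (elements S)

∈-applyUpTo-suc : ∀ {k p} → 0 < k → k ≤ p → k ∈ᴸ applyUpTo suc p
∈-applyUpTo-suc {suc k} _ k<p = ∈-applyUpTo⁺ suc k<p

booleanMatrices : (p : ℕ) → List (Vec (Vec Bool p) p)
booleanMatrices p = vectorsOver (vectorsOver booleans p) p

length-booleanMatrices : ∀ p → length (booleanMatrices p) ≡ 2 ^ p ^ 2
length-booleanMatrices p = begin
  length (vectorsOver (vectorsOver booleans p) p) ≡⟨ length-vectorsOver (vectorsOver booleans p) p ⟩
  length (vectorsOver booleans p) ^ p              ≡⟨ cong (_^ p) (length-vectorsOver booleans p) ⟩
  (2 ^ p) ^ p                                      ≡⟨ ^-*-assoc 2 p p ⟩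
  2 ^ (p * p)                                      ≡⟨ cong (λ e → 2 ^ (p * e)) (*-identityʳ p) ⟨
  2 ^ p ^ 2                                        ∎
  where open ≡-Reasoning

∈-booleanMatrices : ∀ {p} (M : Vec (Vec Bool p) p) → M ∈ᴸ booleanMatrices p
∈-booleanMatrices = ∈-vectorsOver (∈-vectorsOver ∈-booleans)

signatures : (p : ℕ) → List (Signature p)
signatures p = cartesianProduct (applyUpTo suc p) (cartesianProduct (booleanMatrices p) (booleanMatrices p))

length-signatures : ∀ p → length (signatures p) ≡ p * 2 ^ (2 * p ^ 2)
length-signatures p = begin
  length (signatures p)
    ≡⟨ length-cartesianProductWith _,_ (applyUpTo suc p) (cartesianProduct (booleanMatrices p) (booleanMatrices p)) ⟩
  length (applyUpTo suc p) * length (cartesianProduct (booleanMatrices p) (booleanMatrices p))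
    ≡⟨ cong₂ _*_ (length-applyUpTo suc p) (length-cartesianProductWith _,_ (booleanMatrices p) (booleanMatrices p)) ⟩
  p * (length (booleanMatrices p) * length (booleanMatrices p))
    ≡⟨ cong (λ m → p * (m * m)) (length-booleanMatrices p) ⟩
  p * (2 ^ p ^ 2 * 2 ^ p ^ 2)
    ≡⟨ cong (p *_) (^-distribˡ-+-* 2 (p ^ 2) (p ^ 2)) ⟨
  p * 2 ^ (p ^ 2 + p ^ 2)
    ≡⟨ cong (λ e → p * 2 ^ (p ^ 2 + e)) (+-identityʳ (p ^ 2)) ⟨
  p * 2 ^ (2 * p ^ 2) ∎
  where open ≡-Reasoning

signature∈signatures : ∀ {n} (G : Graph n) (S : Subset n) {p K} → Nonempty K → ∣ K ∣ ≤ p →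
  signature G S p K ∈ᴸ signatures p
signature∈signatures G S {p} {K} (_ , x∈K) ∣K∣≤p =
  ∈-cartesianProduct⁺ (∈-applyUpTo-suc (∈-length (∈-elements⁺ x∈K)) (length-elements≤ K ∣K∣≤p))
                      (∈-cartesianProduct⁺ (∈-booleanMatrices _) (∈-booleanMatrices _))

module _ {n : ℕ} (G : Graph n) (S : Subset n) {p : ℕ} {K₁ K₂ : Subset n}
         (∣K₁∣≤p : ∣ K₁ ∣ ≤ p) (∣S∣≤p : ∣ S ∣ ≤ p)
         (same : signature G S p K₁ ≡ signature G S p K₂) where

  private
    e₁ e₂ eS : List (Fin n)
    e₁ = elements K₁
    e₂ = elements K₂
    eS = elements S

    position : Fin n → ℕ
    position u = indexOf _≟ᶠ_ u e₁

    -- The default u is a junk value, only reached for u ∉ K₁.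
    α : Fin n → Fin n
    α u = fromMaybe u (nth e₂ (position u))

    position<p : ∀ {u} → u ∈ K₁ → position u < p
    position<p u∈K₁ = ≤-trans (indexOf<length _≟ᶠ_ e₁ (∈-elements⁺ u∈K₁)) (length-elements≤ K₁ ∣K₁∣≤p)

    nth-position : ∀ {u} → u ∈ K₁ → nth e₁ (position u) ≡ just u
    nth-position u∈K₁ = nth-indexOf _≟ᶠ_ e₁ (∈-elements⁺ u∈K₁)

    nth-α : ∀ {u} → u ∈ K₁ → nth e₂ (position u) ≡ just (α u)
    nth-α {u} u∈K₁ = nth-fromMaybe e₂ u (subst (position u <_) (cong proj₁ same) (indexOf<length _≟ᶠ_ e₁ (∈-elements⁺ u∈K₁)))

    adjᴹ-inside : ∀ {i j} → i < p → j < p → adjᴹ G (nth e₁ i) (nth e₁ j) ≡ adjᴹ G (nth e₂ i) (nth e₂ j)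
    adjᴹ-inside = adjacencyMatrix-≡⇒adjᴹ-≡ G {us = e₁} {e₁} {e₂} {e₂} (cong (proj₁ ∘ proj₂) same)

    adjᴹ-toS : ∀ {i j} → i < p → j < p → adjᴹ G (nth e₁ i) (nth eS j) ≡ adjᴹ G (nth e₂ i) (nth eS j)
    adjᴹ-toS = adjacencyMatrix-≡⇒adjᴹ-≡ G {us = e₁} {eS} {e₂} {eS} (cong (proj₂ ∘ proj₂) same)

    α-into : ∀ u → u ∈ K₁ → α u ∈ K₂
    α-into u u∈K₁ = ∈-elements⁻ K₂ (nth⇒∈ e₂ (nth-α u∈K₁))

    α-injective : ∀ u w → u ∈ K₁ → w ∈ K₁ → α u ≡ α w → u ≡ w
    α-injective u w u∈K₁ w∈K₁ αu≡αw = just-injective (begin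
      just u                ≡⟨ nth-position u∈K₁ ⟨
      nth e₁ (position u)   ≡⟨ cong (nth e₁) position-u≡position-w ⟩
      nth e₁ (position w)   ≡⟨ nth-position w∈K₁ ⟩
      just w                ∎)
      where
      open ≡-Reasoning
      position-u≡position-w : position u ≡ position w
      position-u≡position-w = begin
        position u              ≡⟨ indexOf-nth _≟ᶠ_ (elements-unique K₂) (nth-α u∈K₁) ⟨
        indexOf _≟ᶠ_ (α u) e₂  ≡⟨ cong (λ x → indexOf _≟ᶠ_ x e₂) αu≡αw ⟩
        indexOf _≟ᶠ_ (α w) e₂  ≡⟨ indexOf-nth _≟ᶠ_ (elements-unique K₂) (nth-α w∈K₁) ⟩
        position w              ∎

    α-onto : ∀ v → v ∈ K₂ → ∃ λ u → u ∈ K₁ × α u ≡ v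
    α-onto v v∈K₂ = u , u∈K₁ , just-injective (begin
      just (α u)           ≡⟨ nth-α u∈K₁ ⟨
      nth e₂ (position u)  ≡⟨ cong (nth e₂) (indexOf-nth _≟ᶠ_ (elements-unique K₁) nth-j) ⟩
      nth e₂ j             ≡⟨ nth-indexOf _≟ᶠ_ e₂ (∈-elements⁺ v∈K₂) ⟩
      just v               ∎)
      where
      open ≡-Reasoning
      j = indexOf _≟ᶠ_ v e₂
      u = fromMaybe v (nth e₁ j)
      nth-j : nth e₁ j ≡ just u
      nth-j = nth-fromMaybe e₁ v (subst (j <_) (≡.sym (cong proj₁ same)) (indexOf<length _≟ᶠ_ e₂ (∈-elements⁺ v∈K₂)))
      u∈K₁ = ∈-elements⁻ K₁ (nth⇒∈ e₁ nth-j)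

    α-preserves-adj : ∀ u w → u ∈ K₁ → w ∈ K₁ → adj G (α u) (α w) ≡ adj G u w
    α-preserves-adj u w u∈K₁ w∈K₁ = begin
      adjᴹ G (just (α u)) (just (α w))                   ≡⟨ cong₂ (adjᴹ G) (nth-α u∈K₁) (nth-α w∈K₁) ⟨
      adjᴹ G (nth e₂ (position u)) (nth e₂ (position w)) ≡⟨ adjᴹ-inside (position<p u∈K₁) (position<p w∈K₁) ⟨
      adjᴹ G (nth e₁ (position u)) (nth e₁ (position w)) ≡⟨ cong₂ (adjᴹ G) (nth-position u∈K₁) (nth-position w∈K₁) ⟩
      adjᴹ G (just u) (just w)                           ∎
      where open ≡-Reasoning

    α-preserves-adj-S : ∀ u v → u ∈ K₁ → v ∈ S → adj G (α u) v ≡ adj G u v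
    α-preserves-adj-S u v u∈K₁ v∈S = begin
      adjᴹ G (just (α u)) (just v)                     ≡⟨ cong₂ (adjᴹ G) (nth-α u∈K₁) nth-v ⟨
      adjᴹ G (nth e₂ (position u)) (nth eS (index-v))  ≡⟨ adjᴹ-toS (position<p u∈K₁) index-v<p ⟨
      adjᴹ G (nth e₁ (position u)) (nth eS (index-v))  ≡⟨ cong₂ (adjᴹ G) (nth-position u∈K₁) nth-v ⟩
      adjᴹ G (just u) (just v)                         ∎
      where
      open ≡-Reasoning
      index-v = indexOf _≟ᶠ_ v eS
      nth-v = nth-indexOf _≟ᶠ_ eS (∈-elements⁺ v∈S)
      index-v<p = ≤-trans (indexOf<length _≟ᶠ_ eS (∈-elements⁺ v∈S)) (length-elements≤ S ∣S∣≤p)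

  sameSignature⇒twinBlocks : IsComponent G S K₁ → IsComponent G S K₂ → TwinBlocks G S K₁ K₂
  sameSignature⇒twinBlocks K₁-comp K₂-comp =
    K₁-comp , K₂-comp , α , α-into , α-injective , α-onto , α-preserves-adj , α-preserves-adj-S

record Decisions {n : ℕ} (G : Graph n) (S : Subset n) : Set where
  field
    path?      : ∀ u v → Dec (PathAvoid G S u v)
    component? : Decidable (IsComponent G S)
    twins?     : ∀ H K → Dec (TwinBlocks G S H K)

¬¬-decisions : ∀ {n} (G : Graph n) (S : Subset n) → ¬ ¬ Decisions G S
¬¬-decisions {n} G S = do
  path?      ← ¬¬-∀-vertices λ u → ¬¬-∀-vertices λ v → ¬¬-excluded-middle
  component? ← ¬¬-∀-subsets λ K → ¬¬-excluded-middle
  twins?     ← ¬¬-∀-subsets λ H → ¬¬-∀-subsets λ K → ¬¬-excluded-middle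
  pure record { path? = path? ; component? = component? ; twins? = twins? }
  where
  open RawMonad ¬¬-Monad
  ¬¬-∀-vertices : {P : Fin n → Set} → (∀ v → ¬ ¬ P v) → ¬ ¬ (∀ v → P v)
  ¬¬-∀-vertices = ¬¬-∀-enumerated (allFin n) ∈-allFin
  ¬¬-∀-subsets : {P : Subset n → Set} → (∀ K → ¬ ¬ P K) → ¬ ¬ (∀ K → P K)
  ¬¬-∀-subsets = ¬¬-∀-enumerated (subsets n) ∈-subsets

module _ {n : ℕ} {G : Graph n} {S : Subset n} {p : ℕ} {R : Subset n}
         (witness : Witnesses≤ G S p) (reduced : IsReduced G S p R) (decisions : Decisions G S) where

  open Decisions decisions

  private
    ∣S∣≤p : ∣ S ∣ ≤ p
    ∣S∣≤p = proj₁ witness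

    ∣K∣≤p : ∀ {K} → IsComponent G S K → ∣ K ∣ ≤ p
    ∣K∣≤p {K} K-comp = ≤-trans (∣p∣≤∣p∪q∣ K S) (proj₂ witness K K-comp)

    componentInR? : Decidable (λ K → IsComponent G S K × K ⊆ R)
    componentInR? K = component? K ×-dec K ⊆? R

    componentsInR : List (Subset n)
    componentsInR = filter componentInR? (subsets n)

    ∈-componentsInR⁻ : ∀ {K} → K ∈ᴸ componentsInR → IsComponent G S K × K ⊆ R
    ∈-componentsInR⁻ = proj₂ ∘ ∈-filter⁻ componentInR? {xs = subsets n}

    twinInR? : (H : Subset n) → Decidable (λ K → TwinBlocks G S H K × K ⊆ R)
    twinInR? H K = twins? H K ×-dec K ⊆? R

    twinsInR : Subset n → List (Subset n)
    twinsInR H = filter (twinInR? H) (subsets n)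

    twinsInR≤f : ∀ {H} → IsComponent G S H → length (twinsInR H) ≤ f p
    twinsInR≤f {H} H-comp with f p ≤? length (filter (twins? H) (subsets n))
                              | proj₂ (proj₂ reduced) H _ _ H-comp (countIs-filter (twins? H)) (countIs-filter (twinInR? H))
    ... | yes large | (M≡f , _) = ≤-reflexive (M≡f large)
    ... | no  small | (_ , M≡N) = ≤-trans (≤-reflexive (M≡N (≰⇒> small))) (<⇒≤ (≰⇒> small))

    sameSignature≤f : ∀ σ {Ks} → Unique Ks → (∀ {K} → K ∈ᴸ Ks → K ∈ᴸ componentsInR × signature G S p K ≡ σ) →
      length Ks ≤ f p
    sameSignature≤f σ {[]}     _   _ = z≤n
    sameSignature≤f σ {H ∷ Ks} Ks! all-σ = ≤-trans (Unique⇒length≤ Ks! ⊆twinsInR) (twinsInR≤f H-comp)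
      where
      H-comp = proj₁ (∈-componentsInR⁻ (proj₁ (all-σ (here refl))))
      ⊆twinsInR : H ∷ Ks ⊆ᴸ twinsInR H
      ⊆twinsInR {K} K∈ =
        let (K∈R , σK) = all-σ K∈
            (K-comp , K⊆R) = ∈-componentsInR⁻ K∈R
            σH≡σK = ≡.trans (proj₂ (all-σ (here refl))) (≡.sym σK)
        in ∈-filter⁺ (twinInR? H) (∈-subsets K)
             (sameSignature⇒twinBlocks G S (∣K∣≤p H-comp) ∣S∣≤p σH≡σK H-comp K-comp , K⊆R)

    componentsInR≤ : length componentsInR ≤ length (signatures p) * f p
    componentsInR≤ =
      length≤-fibres _≟ˢ_ (signature G S p) (f p) (signatures p) (filter⁺ componentInR? (subsets-unique n))
        (λ K∈ → let (K-comp , _) = ∈-componentsInR⁻ K∈ in signature∈signatures G S (proj₁ K-comp) (∣K∣≤p K-comp))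
        sameSignature≤f

    meetsR⇒⊆R : ∀ {K v} → IsComponent G S K → v ∈ K → v ∈ R → K ⊆ R
    meetsR⇒⊆R {K} {v} K-comp v∈K v∈R with proj₁ (proj₂ reduced) K K-comp
    ... | inj₁ K⊆R   = K⊆R
    ... | inj₂ K∩R≡∅ = contradiction v∈R (K∩R≡∅ v v∈K)

    ∉S⇒∈componentInR : ∀ {v} → v ∈ R → v ∉ S → ∃ λ K → K ∈ᴸ componentsInR × v ∈ K
    ∉S⇒∈componentInR {v} v∈R v∉S =
      K , ∈-filter⁺ componentInR? (∈-subsets K) (K-comp , meetsR⇒⊆R K-comp v∈K v∈R) , v∈K
      where
      K = reachableFrom G S path? v
      K-comp = reachableFrom-component G S path? v∉S
      v∈K = ∈-reachableFrom⁺ G S path? (here v∉S)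

    R⊆S∪componentsInR : elements R ⊆ᴸ elements S ++ concatMap elements componentsInR
    R⊆S∪componentsInR {v} v∈R with v ∈? S
    ... | yes v∈S = ∈-++⁺ˡ (∈-elements⁺ v∈S)
    ... | no  v∉S = let (K , K∈ , v∈K) = ∉S⇒∈componentInR (∈-elements⁻ R v∈R) v∉S
                    in ∈-++⁺ʳ (elements S) (∈-concat⁺′ (∈-elements⁺ v∈K) (∈-map⁺ elements K∈))

  ∣reduced∣≤ : ∣ R ∣ ≤ p + length (signatures p) * f p * p
  ∣reduced∣≤ = begin
    ∣ R ∣                                                   ≡⟨ length-elements R ⟨
    length (elements R)                                     ≤⟨ Unique⇒length≤ (elements-unique R) R⊆S∪componentsInR ⟩
    length (elements S ++ concatMap elements componentsInR) ≡⟨ length-++ (elements S) ⟩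
    length (elements S) + length (concatMap elements componentsInR)
      ≤⟨ +-mono-≤ (length-elements≤ S ∣S∣≤p)
                  (length-concatMap≤ elements componentsInR (λ {K} → length-elements≤ K ∘ ∣K∣≤p ∘ proj₁ ∘ ∈-componentsInR⁻)) ⟩
    p + length componentsInR * p                            ≤⟨ +-monoʳ-≤ p (*-monoˡ-≤ p componentsInR≤) ⟩
    p + length (signatures p) * f p * p                     ∎
    where open ≤-Reasoning

mainTheorem10 : ∀ {n} (G : Graph n) (S : Subset n) (p : ℕ) → WitnessesVI G S p
    → (R : Subset n) → IsReduced G S p R
    → ∣ R ∣ ≤ p + p ^ 2 * f p * 2 ^ (2 * p ^ 2)
mainTheorem10 G S p (_ , witness) R reduced =
  decidable-stable (_ ≤? _) (¬¬-map bound (¬¬-decisions G S))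
  where
  open +-*-Solver
  bound : Decisions G S → ∣ R ∣ ≤ p + p ^ 2 * f p * 2 ^ (2 * p ^ 2)
  bound decisions = subst (λ m → ∣ R ∣ ≤ p + m) count≡ (∣reduced∣≤ witness reduced decisions)
    where
    count≡ : length (signatures p) * f p * p ≡ p ^ 2 * f p * 2 ^ (2 * p ^ 2)
    count≡ = ≡.trans (cong (λ c → c * f p * p) (length-signatures p))
               (solve 3 (λ p F T → p :* T :* F :* p := p :^ 2 :* F :* T) refl p (f p) (2 ^ (2 * p ^ 2)))
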